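{- Let $\mathcal{M}$ be a monster model of $T_p$ and let $F,F'$ be two swiss cheeses in $\mathcal{M}$ of radiuses $\gamma\le\gamma'$ respectively. If $F\cap F'\neq\emptyset$, then $F\cup F'$ is also a swiss cheese, of radius exactly $\gamma$. Moreover, given representations of $F$ and $F'$ (outer ball minus holes), $F\cup F'$ has a representation whose set of holes is a subset of the union of the set of holes of $F$ and the set of holes of $F'$.
   Context: $T_p$ is the complete theory of the two-sorted structure with main sort $(\mathbb{Z},+,0)$, value sort $(\mathbb{N}\cup\{\infty\},<,0,S,\infty)$ ($S$ the successor), and the $p$-adic valuation $v=v_p$ from the main sort to the value sort. In a model $\mathcal{M}$ with main sort $M$ and value sort $\Gamma$: for $a\in M$, $\gamma\in\Gamma$, $\gamma\ne\infty$, the ball of radius $\gamma$ around $a$ is $B(a,\gamma)=\{x\in M: v(x-a)\ge\gamma\}$; its radius $rad(B(a,\gamma))=\gamma$ is well defined. A swiss cheese is a nonempty set of the form $B_0\setminus\bigcup_{i=1}^n B_i$ with $B_0,\dots,B_n$ balls. Every swiss cheese $F$ is contained in a unique minimal (under inclusion) ball, its outer ball, and $rad(F)$ is the radius of its outer ball. A representation of $F$ is an expression $F=B_0\setminus\bigcup_{i=1}^nB_i$ where $B_0$ is the outer ball and $B_1,\dots,B_n$ (the holes) are nonempty, pairwise disjoint balls contained in $B_0$. -}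

module Defs where

open import Data.Nat as ℕ using (ℕ; zero; suc)
open import Data.Nat.Divisibility using (_∣?_; quotient)
open import Data.Integer as ℤ using (ℤ)
open import Data.Fin using (Fin; zero; suc)
open import Data.Product using (Σ; _×_; _,_)
open import Data.Sum using (_⊎_)
open import Data.Empty using (⊥)
open import Data.List using (List)
open import Data.List.Relation.Unary.All using (All)
open import Data.List.Relation.Unary.AllPairs using (AllPairs)
open import Relation.Binary.PropositionalEquality using (_≡_; _≢_)
open import Relation.Nullary using (¬_; yes; no)

record Structure : Set₁ where
  field
    M   : Set
    Γ   : Set
    0M  : M
    _⊕_ : M → M → M
    _≺_ : Γ → Γ → Set
    0Γ  : Γ
    S   : Γ → Γ
    ∞Γ  : Γ
    v   : M → Γ

-- First-order formulas of the signature (de Bruijn; n main-sort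
-- variables, m value-sort variables in context).

data MTerm (n : ℕ) : Set where
  var   : Fin n → MTerm n
  zero' : MTerm n
  _+'_  : MTerm n → MTerm n → MTerm n

data VTerm (n m : ℕ) : Set where
  var   : Fin m → VTerm n m
  zero' : VTerm n m
  succ' : VTerm n m → VTerm n m
  inf'  : VTerm n m
  val'  : MTerm n → VTerm n m

data Formula (n m : ℕ) : Set where
  ⊥'   : Formula n m
  _≐M_ : MTerm n → MTerm n → Formula n m
  _≐V_ : VTerm n m → VTerm n m → Formula n m
  _<'_ : VTerm n m → VTerm n m → Formula n m
  _∧'_ : Formula n m → Formula n m → Formula n m
  _∨'_ : Formula n m → Formula n m → Formula n m
  _⇒'_ : Formula n m → Formula n m → Formula n m
  ∀M   : Formula (suc n) m → Formula n m
  ∃M   : Formula (suc n) m → Formula n m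
  ∀V   : Formula n (suc m) → Formula n m
  ∃V   : Formula n (suc m) → Formula n m

Sentence : Set
Sentence = Formula 0 0

-- Tarski semantics (negation is φ ⇒' ⊥').

ext : ∀ {A : Set} {n} → (Fin n → A) → A → Fin (suc n) → A
ext ρ a zero    = a
ext ρ a (suc i) = ρ i

module Semantics (𝓜 : Structure) where
  open Structure 𝓜

  evalM : ∀ {n} → (Fin n → M) → MTerm n → M
  evalM ρ (var i)  = ρ i
  evalM ρ zero'    = 0M
  evalM ρ (s +' t) = evalM ρ s ⊕ evalM ρ t

  evalV : ∀ {n m} → (Fin n → M) → (Fin m → Γ) → VTerm n m → Γ
  evalV ρ σ (var i)   = σ i
  evalV ρ σ zero'     = 0Γ
  evalV ρ σ (succ' s) = S (evalV ρ σ s)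
  evalV ρ σ inf'      = ∞Γ
  evalV ρ σ (val' t)  = v (evalM ρ t)

  Sat : ∀ {n m} → (Fin n → M) → (Fin m → Γ) → Formula n m → Set
  Sat ρ σ ⊥'       = ⊥
  Sat ρ σ (s ≐M t) = evalM ρ s ≡ evalM ρ t
  Sat ρ σ (s ≐V t) = evalV ρ σ s ≡ evalV ρ σ t
  Sat ρ σ (s <' t) = evalV ρ σ s ≺ evalV ρ σ t
  Sat ρ σ (φ ∧' ψ) = Sat ρ σ φ × Sat ρ σ ψ
  Sat ρ σ (φ ∨' ψ) = Sat ρ σ φ ⊎ Sat ρ σ ψ
  Sat ρ σ (φ ⇒' ψ) = Sat ρ σ φ → Sat ρ σ ψ
  Sat ρ σ (∀M φ)   = (a : M) → Sat (ext ρ a) σ φ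
  Sat ρ σ (∃M φ)   = Σ M λ a → Sat (ext ρ a) σ φ
  Sat ρ σ (∀V φ)   = (g : Γ) → Sat ρ (ext σ g) φ
  Sat ρ σ (∃V φ)   = Σ Γ λ g → Sat ρ (ext σ g) φ

  Satisfies : Sentence → Set
  Satisfies φ = Sat (λ ()) (λ ()) φ

data ℕ∞ : Set where
  fin : ℕ → ℕ∞
  ∞   : ℕ∞

data _<∞_ : ℕ∞ → ℕ∞ → Set where
  fin<fin : ∀ {a b} → a ℕ.< b → fin a <∞ fin b
  fin<∞   : ∀ {a} → fin a <∞ ∞

succ∞ : ℕ∞ → ℕ∞
succ∞ (fin a) = fin (suc a)
succ∞ ∞       = ∞

-- p-adic valuation of a positive natural n (fuel-bounded; fuel n suffices
-- for p ≥ 2): the exponent of p in n.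
vℕ : (p : ℕ) → (fuel n : ℕ) → ℕ
vℕ p zero       n = 0
vℕ p (suc fuel) zero = 0
vℕ p (suc fuel) (suc n) with p ∣? suc n
... | yes d = suc (vℕ p fuel (quotient d))
... | no  _ = 0

vp : ℕ → ℤ → ℕ∞
vp p (ℤ.+ zero)    = ∞
vp p x             = fin (vℕ p ℤ.∣ x ∣ ℤ.∣ x ∣)

standard : ℕ → Structure
standard p = record
  { M = ℤ ; Γ = ℕ∞ ; 0M = ℤ.0ℤ ; _⊕_ = ℤ._+_ ; _≺_ = _<∞_
  ; 0Γ = fin 0 ; S = succ∞ ; ∞Γ = ∞ ; v = vp p }

-- 𝓜 is a model of T_p = Th(standard p) (T_p is complete, so this is the
-- same as 𝓜 ⊨ T_p).
IsModelOfTp : ℕ → Structure → Set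
IsModelOfTp p 𝓜 =
  (φ : Sentence) → Semantics.Satisfies (standard p) φ → Semantics.Satisfies 𝓜 φ

module Cheese (𝓜 : Structure) where
  open Structure 𝓜

  Pred : Set₁
  Pred = M → Set

  _⊆_ : Pred → Pred → Set
  P ⊆ Q = ∀ x → P x → Q x

  _≐_ : Pred → Pred → Set
  P ≐ Q = (P ⊆ Q) × (Q ⊆ P)

  _∪_ : Pred → Pred → Pred
  (P ∪ Q) x = P x ⊎ Q x

  _≤Γ_ : Γ → Γ → Set
  γ ≤Γ δ = (γ ≺ δ) ⊎ (γ ≡ δ)

  record Ball : Set where
    constructor ball
    field
      center   : M
      radius   : Γ
      radius≢∞ : radius ≢ ∞Γ
  open Ball public

  -- x ∈ B(a,γ)  iff  v(x - a) ≥ γ, where x - a is the d with a + d = x.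
  _∈B_ : M → Ball → Set
  x ∈B B = Σ M λ d → ((center B ⊕ d) ≡ x) × (radius B ≤Γ v d)

  ballSet : Ball → Pred
  ballSet B x = x ∈B B

  Nonempty : Pred → Set
  Nonempty P = Σ M P

  Disjoint : Ball → Ball → Set
  Disjoint B B' = ∀ x → x ∈B B → x ∈B B' → ⊥

  Diff : Ball → List Ball → Pred
  Diff B₀ Bs x = (x ∈B B₀) × All (λ B → ¬ (x ∈B B)) Bs

  IsSwissCheese : Pred → Set
  IsSwissCheese F =
    Nonempty F × Σ Ball λ B₀ → Σ (List Ball) λ Bs → F ≐ Diff B₀ Bs

  IsOuterBall : Pred → Ball → Set
  IsOuterBall F B = (F ⊆ ballSet B) × ((B' : Ball) → F ⊆ ballSet B' → ballSet B ⊆ ballSet B')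

  HasRadius : Pred → Γ → Set
  HasRadius F γ = Σ Ball λ B → IsOuterBall F B × (radius B ≡ γ)

  record Representation (F : Pred) : Set where
    field
      outer          : Ball
      holes          : List Ball
      outerIsOuter   : IsOuterBall F outer
      holesNonempty  : All (λ B → Nonempty (ballSet B)) holes
      holesDisjoint  : AllPairs Disjoint holes
      holesInOuter   : All (λ B → ballSet B ⊆ ballSet outer) holes
      represents     : F ≐ Diff outer holes
  open Representation public

-- In (ℤ, v_p) the ball B(a, γ) is the coset a + p^γ ℤ, so membership in a ball is decidable,
-- a ball contains its centre, and two balls with a common point are nested, the one of smaller
-- radius containing the other. These are first-order sentences, hence true in every model of
-- T_p, and they are all the argument uses. Let F = B ∖ ⋃ Cs and F' = B' ∖ ⋃ Cs' with outer balls
-- B, B' of radii γ ≤ γ' and a common point z. Then B' ⊆ B, so B is the outer ball of F ∪ F', and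
-- a point of B lies outside F ∪ F' iff it lies in some hole C of F and in B'ᶜ ∪ ⋃ Cs'. For a
-- hole C this set is C when C is disjoint from B', and the union of the balls C ∩ C' (each of
-- them C, C' or empty) when C ⊆ B'; the case B' ⊊ C is excluded by z ∈ B' ∖ C.

module Submission where

open import Defs
open import Data.Nat using (ℕ)
open import Data.Nat.Primality using (Prime)
open import Data.Product using (Σ; _×_)
open import Data.List using (_++_)
open import Data.List.Relation.Unary.All using (All)
open import Data.List.Relation.Unary.Any using (Any)

open import Data.Nat as ℕ using (zero; suc; _≤_; _<_; z≤n; s≤s; _^_)
import Data.Nat.Properties as ℕ
open import Data.Nat.Divisibility as ℕ using (_∣?_; divides)
import Data.Nat.Primality as Prime
open import Data.Integer as ℤ using (ℤ; +_; -[1+_]; _-_)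
import Data.Integer.Properties as ℤ
open import Data.Integer.Divisibility.Signed as ℤ∣ using (∣ᵤ⇒∣; ∣⇒∣ᵤ)
open import Data.Integer.Solver using (module +-*-Solver)
open import Data.Fin using (Fin; zero; suc; #_)
open import Data.List using (List; []; _∷_; [_]; concatMap)
open import Data.List.Relation.Unary.All as All using ([]; _∷_)
open import Data.List.Relation.Unary.All.Properties using (¬Any⇒All¬; All¬⇒¬Any)
import Data.List.Relation.Unary.All.Properties as All
open import Data.List.Relation.Unary.Any as Any using (here; there; any?)
open import Data.List.Relation.Unary.Any.Properties using (concatMap⁺; concatMap⁻; singleton⁻)
open import Data.List.Relation.Unary.AllPairs as AllPairs using (AllPairs; []; _∷_)
import Data.List.Relation.Unary.AllPairs.Properties as AllPairs
open import Data.List.Membership.Propositional using (_∈_; find; lose)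
open import Data.List.Membership.Propositional.Properties using (∈-concatMap⁻; ∈-++⁺ˡ; ∈-++⁺ʳ)
open import Data.List.Relation.Binary.Subset.Propositional using () renaming (_⊆_ to _⊆ˡ_)
open import Data.Product using (_,_; proj₁; proj₂)
open import Data.Sum using (_⊎_; inj₁; inj₂; [_,_]′)
open import Function using (_∘_; id; case_of_)
open import Function.Bundles using (_⇔_; mk⇔; Equivalence)
open import Function.Construct.Symmetry using (⇔-sym)
open import Function.Related.Propositional using (module EquationalReasoning)
open import Relation.Binary.PropositionalEquality using (_≡_; refl; sym; subst; cong)
open import Relation.Nullary using (¬_; Dec; yes; no; contradiction)
open import Relation.Nullary.Decidable using (map′; toSum; fromSum)

open Equivalence using (to; from)

_≤∞_ : ℕ∞ → ℕ∞ → Set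
g ≤∞ h = g <∞ h ⊎ g ≡ h

fin-≤∞⇔≤ : ∀ {m n} → fin m ≤∞ fin n ⇔ m ≤ n
fin-≤∞⇔≤ = mk⇔ to′ from′
  where
  to′ : ∀ {m n} → fin m ≤∞ fin n → m ≤ n
  to′ (inj₁ (fin<fin m<n)) = ℕ.<⇒≤ m<n
  to′ (inj₂ refl)          = ℕ.≤-refl
  from′ : ∀ {m n} → m ≤ n → fin m ≤∞ fin n
  from′ m≤n = [ inj₁ ∘ fin<fin , inj₂ ∘ cong fin ]′ (ℕ.m≤n⇒m<n∨m≡n m≤n)

≤∞-total : ∀ g h → g ≤∞ h ⊎ h ≤∞ g
≤∞-total (fin m) (fin n) with ℕ.≤-total m n
... | inj₁ m≤n = inj₁ (from fin-≤∞⇔≤ m≤n)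
... | inj₂ n≤m = inj₂ (from fin-≤∞⇔≤ n≤m)
≤∞-total (fin m) ∞ = inj₁ (inj₁ fin<∞)
≤∞-total ∞ (fin n) = inj₂ (inj₁ fin<∞)
≤∞-total ∞ ∞       = inj₁ (inj₂ refl)

module PAdic (p : ℕ) (1<p : 1 < p) where

  private instance
    p-nonZero : ℕ.NonZero p
    p-nonZero = ℕ.>-nonZero (ℕ.<-trans (s≤s z≤n) 1<p)

  p^suc∣*p⇔p^∣ : ∀ n q → p ^ suc n ℕ.∣ q ℕ.* p ⇔ p ^ n ℕ.∣ q
  p^suc∣*p⇔p^∣ n q rewrite ℕ.*-comm q p = mk⇔ (ℕ.*-cancelˡ-∣ p) (ℕ.*-monoʳ-∣ p)

  quotient<dividend : ∀ {q m} → suc m ≡ q ℕ.* p → q < suc m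
  quotient<dividend {suc q} eq = subst (suc q <_) (sym eq) (ℕ.m<m*n (suc q) p 1<p)

  ≤vℕ⇔p^∣ : ∀ {fuel m} n → suc m ≤ fuel → n ≤ vℕ p fuel (suc m) ⇔ p ^ n ℕ.∣ suc m
  ≤vℕ⇔p^∣ {suc fuel} {m} n (s≤s m≤fuel) with p ∣? suc m
  ≤vℕ⇔p^∣ zero _ | _ = mk⇔ (λ _ → ℕ.1∣ _) (λ _ → z≤n)
  ≤vℕ⇔p^∣ (suc n) _ | no p∤m =
    mk⇔ (λ ()) (λ p^n∣m → contradiction (ℕ.∣-trans (ℕ.m∣m*n (p ^ n)) p^n∣m) p∤m)
  ≤vℕ⇔p^∣ (suc n) _ | yes (divides zero ())
  ≤vℕ⇔p^∣ {suc fuel} {m} (suc n) (s≤s m≤fuel) | yes (divides q@(suc q′) eq) = begin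
    suc n ≤ suc (vℕ p fuel q)  ∼⟨ mk⇔ ℕ.s≤s⁻¹ s≤s ⟩
    n ≤ vℕ p fuel q            ∼⟨ ≤vℕ⇔p^∣ n q≤fuel ⟩
    p ^ n ℕ.∣ q                ∼⟨ ⇔-sym (p^suc∣*p⇔p^∣ n q) ⟩
    p ^ suc n ℕ.∣ q ℕ.* p      ≡⟨ cong (p ^ suc n ℕ.∣_) (sym eq) ⟩
    p ^ suc n ℕ.∣ suc m        ∎
    where
    open EquationalReasoning
    q≤fuel : q ≤ fuel
    q≤fuel = ℕ.≤-trans (ℕ.s≤s⁻¹ (quotient<dividend eq)) m≤fuel

  p^-mono-∣ : ∀ {m n} → m ≤ n → p ^ m ℕ.∣ p ^ n
  p^-mono-∣ z≤n       = ℕ.1∣ _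
  p^-mono-∣ (s≤s m≤n) = ℕ.*-monoʳ-∣ p (p^-mono-∣ m≤n)

  infix 4 p^_∣_
  p^_∣_ : ℕ∞ → ℤ → Set
  p^ fin n ∣ x = + (p ^ n) ℤ∣.∣ x
  p^ ∞ ∣ x     = x ≡ + 0

  p^∣0 : ∀ g → p^ g ∣ + 0
  p^∣0 (fin n) = ℤ∣.divides (+ 0) refl
  p^∣0 ∞       = refl

  p^∣-+ : ∀ g {x y} → p^ g ∣ x → p^ g ∣ y → p^ g ∣ x ℤ.+ y
  p^∣-+ (fin n) = ℤ∣.∣m∣n⇒∣m+n
  p^∣-+ ∞ refl refl = refl

  p^∣-- : ∀ g {x y} → p^ g ∣ x → p^ g ∣ y → p^ g ∣ x - y
  p^∣-- (fin n) = ℤ∣.∣m∣n⇒∣m-n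
  p^∣-- ∞ refl refl = refl

  p^∣-antimono : ∀ {g h x} → g ≤∞ h → p^ h ∣ x → p^ g ∣ x
  p^∣-antimono {fin m} {fin n} m≤n = ℤ∣.∣-trans (∣ᵤ⇒∣ (p^-mono-∣ (to fin-≤∞⇔≤ m≤n)))
  p^∣-antimono {fin m} {∞} _ refl = p^∣0 (fin m)
  p^∣-antimono {∞} {fin _} (inj₁ ())
  p^∣-antimono {∞} {fin _} (inj₂ ())
  p^∣-antimono {∞} {∞} _ x≡0 = x≡0

  p^∣? : ∀ g x → Dec (p^ g ∣ x)
  p^∣? (fin n) x = + (p ^ n) ℤ∣.∣? x
  p^∣? ∞ x       = x ℤ.≟ + 0

  ≤vp⇔p^∣-nonzero : ∀ n {k} x → ℤ.∣ x ∣ ≡ suc k →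
                    fin n ≤∞ fin (vℕ p (suc k) (suc k)) ⇔ p^ fin n ∣ x
  ≤vp⇔p^∣-nonzero n {k} x ∣x∣≡1+k = begin
    fin n ≤∞ fin (vℕ p (suc k) (suc k))  ∼⟨ fin-≤∞⇔≤ ⟩
    n ≤ vℕ p (suc k) (suc k)             ∼⟨ ≤vℕ⇔p^∣ n ℕ.≤-refl ⟩
    p ^ n ℕ.∣ suc k                      ≡⟨ cong (p ^ n ℕ.∣_) (sym ∣x∣≡1+k) ⟩
    p ^ n ℕ.∣ ℤ.∣ x ∣                    ∼⟨ mk⇔ ∣ᵤ⇒∣ ∣⇒∣ᵤ ⟩
    p^ fin n ∣ x                         ∎
    where open EquationalReasoning

  ≤vp⇔p^∣ : ∀ g x → g ≤∞ vp p x ⇔ p^ g ∣ x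
  ≤vp⇔p^∣ g       (+ zero)   = mk⇔ (λ _ → p^∣0 g) (λ _ → ≤∞-∞ g)
    where
    ≤∞-∞ : ∀ g → g ≤∞ ∞
    ≤∞-∞ (fin _) = inj₁ fin<∞
    ≤∞-∞ ∞       = inj₂ refl
  ≤vp⇔p^∣ (fin n) x@(+ suc _) = ≤vp⇔p^∣-nonzero n x refl
  ≤vp⇔p^∣ (fin n) x@(-[1+ _ ]) = ≤vp⇔p^∣-nonzero n x refl
  ≤vp⇔p^∣ ∞       (+ suc _)   = mk⇔ (λ { (inj₁ ()) ; (inj₂ ()) }) (λ ())
  ≤vp⇔p^∣ ∞       -[1+ _ ]    = mk⇔ (λ { (inj₁ ()) ; (inj₂ ()) }) (λ ())

  infix 4 _∈[_,_]
  _∈[_,_] : ℤ → ℤ → ℕ∞ → Set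
  x ∈[ a , g ] = Σ ℤ λ d → a ℤ.+ d ≡ x × g ≤∞ vp p d

  open +-*-Solver

  ∈[]⇔p^∣ : ∀ {x a g} → x ∈[ a , g ] ⇔ p^ g ∣ x - a
  ∈[]⇔p^∣ {x} {a} {g} = mk⇔
    (λ { (d , refl , g≤vd) → subst (p^ g ∣_) (solve 2 (λ a d → d := (a :+ d) :- a) refl a d)
                                    (to (≤vp⇔p^∣ g d) g≤vd) })
    (λ p^g∣x-a → x - a , solve 2 (λ a x → a :+ (x :- a) := x) refl a x ,
                 from (≤vp⇔p^∣ g _) p^g∣x-a)

  ∈[]-or-∉[] : ∀ x a g → x ∈[ a , g ] ⊎ ¬ x ∈[ a , g ]
  ∈[]-or-∉[] x a g = toSum (map′ (from ∈[]⇔p^∣) (to ∈[]⇔p^∣) (p^∣? g (x - a)))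

  center∈[] : ∀ a g → a ∈[ a , g ]
  center∈[] a g = from ∈[]⇔p^∣ (subst (p^ g ∣_) (sym (ℤ.+-inverseʳ a)) (p^∣0 g))

  ∈[]-nested : ∀ a b g h → g ≤∞ h → ∀ z → z ∈[ a , g ] → z ∈[ b , h ] →
               ∀ x → x ∈[ b , h ] → x ∈[ a , g ]
  ∈[]-nested a b g h g≤h z z∈a z∈b x x∈b = from ∈[]⇔p^∣ (subst (p^ g ∣_) x-a≡
    (p^∣-+ g (p^∣-antimono g≤h (p^∣-- h (to ∈[]⇔p^∣ x∈b) (to ∈[]⇔p^∣ z∈b))) (to ∈[]⇔p^∣ z∈a)))
    where
    x-a≡ : (x - b) - (z - b) ℤ.+ (z - a) ≡ x - a
    x-a≡ = solve 4 (λ a b z x → ((x :- b) :- (z :- b)) :+ (z :- a) := x :- a) refl a b z x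

-- Sentences use de Bruijn indices (# 0 is the innermost bound variable of its sort), and
-- x ∈′[ a , g ] expresses x ∈ B(a, g), i.e. ∃ d. a + d = x ∧ g ≤ v(d).
infix 4 _≤′_ _∈′[_,_]
_≤′_ : ∀ {n m} → VTerm n m → VTerm n m → Formula n m
s ≤′ t = (s <' t) ∨' (s ≐V t)

¬′_ : ∀ {n m} → Formula n m → Formula n m
¬′ φ = φ ⇒' ⊥'

_∈′[_,_] : ∀ {n m} → Fin n → Fin n → Fin m → Formula n m
x ∈′[ a , g ] = ∃M (((var (suc a) +' var zero) ≐M var (suc x)) ∧' (var g ≤′ val' (var zero)))

ball-membership-decidable center-in-ball balls-nested value-order-total : Sentence
ball-membership-decidable = ∀M (∀M (∀V ((# 1 ∈′[ # 0 , # 0 ]) ∨' (¬′ (# 1 ∈′[ # 0 , # 0 ])))))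
center-in-ball = ∀M (∀V (# 0 ∈′[ # 0 , # 0 ]))
balls-nested = ∀M (∀M (∀V (∀V ((var (# 1) ≤′ var (# 0)) ⇒'
  ∀M ((# 0 ∈′[ # 2 , # 1 ]) ⇒' ((# 0 ∈′[ # 1 , # 0 ]) ⇒'
  ∀M ((# 0 ∈′[ # 2 , # 0 ]) ⇒' (# 0 ∈′[ # 3 , # 1 ]))))))))
value-order-total = ∀V (∀V ((var (# 1) ≤′ var (# 0)) ∨' (var (# 0) ≤′ var (# 1))))

module _ (𝓜 : Structure) where
  open Cheese 𝓜

  record BallAxioms : Set where
    field
      _∈B?_     : ∀ x B → Dec (x ∈B B)
      center∈B  : ∀ B → center B ∈B B
      ≤Γ-total  : ∀ γ δ → γ ≤Γ δ ⊎ δ ≤Γ γ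
      ∈B-nested : ∀ B B' → radius B ≤Γ radius B' → ∀ z → z ∈B B → z ∈B B' →
                  ballSet B' ⊆ ballSet B

-- Satisfaction of each sentence in standard p unfolds to the type of the matching lemma of
-- PAdic, and in 𝓜 to the type of the matching field.
ballAxioms : ∀ p → Prime p → ∀ 𝓜 → IsModelOfTp p 𝓜 → BallAxioms 𝓜
ballAxioms p p-prime 𝓜 ⊨Tp = record
  { _∈B?_     = λ x B → fromSum (⊨Tp ball-membership-decidable ∈[]-or-∉[] x (center B) (radius B))
  ; center∈B  = λ B → ⊨Tp center-in-ball center∈[] (center B) (radius B)
  ; ≤Γ-total  = ⊨Tp value-order-total ≤∞-total
  ; ∈B-nested = λ B B' → ⊨Tp balls-nested ∈[]-nested (center B) (center B') (radius B) (radius B')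
  }
  where
  open Cheese 𝓜 using (center; radius)
  open PAdic p (ℕ.nonTrivial⇒n>1 p {{Prime.prime⇒nonTrivial p-prime}})

module BallCombinatorics {𝓜 : Structure} (axioms : BallAxioms 𝓜) where
  open Structure 𝓜
  open Cheese 𝓜
  open BallAxioms axioms

  infix 4 _⊆ᴮ_ _∈⋃_
  _⊆ᴮ_ : Ball → Ball → Set
  B ⊆ᴮ B' = ballSet B ⊆ ballSet B'

  _∈⋃_ : M → List Ball → Set
  x ∈⋃ Bs = Any (x ∈B_) Bs

  ⊆-refl : ∀ {P} → P ⊆ P
  ⊆-refl _ Px = Px

  ≐-refl : ∀ {P} → P ≐ P
  ≐-refl = ⊆-refl , ⊆-refl

  Disjoint-⊆ : ∀ {A A' B B'} → A ⊆ᴮ B → A' ⊆ᴮ B' → Disjoint B B' → Disjoint A A'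
  Disjoint-⊆ A⊆B A'⊆B' B#B' x x∈A x∈A' = B#B' x (A⊆B x x∈A) (A'⊆B' x x∈A')

  ≤radius⇒⊇-or-disjoint : ∀ B B' → radius B ≤Γ radius B' → B' ⊆ᴮ B ⊎ Disjoint B B'
  ≤radius⇒⊇-or-disjoint B B' r≤r' with center B' ∈B? B
  ... | yes c'∈B = inj₁ (∈B-nested B B' r≤r' (center B') c'∈B (center∈B B'))
  ... | no  c'∉B = inj₂ λ x x∈B x∈B' →
    c'∉B (∈B-nested B B' r≤r' x x∈B x∈B' (center B') (center∈B B'))

  nested-or-disjoint : ∀ B B' → B ⊆ᴮ B' ⊎ B' ⊆ᴮ B ⊎ Disjoint B B'
  nested-or-disjoint B B' with ≤Γ-total (radius B) (radius B')
  ... | inj₁ r≤r' = inj₂ (≤radius⇒⊇-or-disjoint B B' r≤r')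
  ... | inj₂ r'≤r = [ inj₁ , (λ B'#B → inj₂ (inj₂ λ x x∈B x∈B' → B'#B x x∈B' x∈B)) ]′
                      (≤radius⇒⊇-or-disjoint B' B r'≤r)

  infixl 7 _⊓_
  _⊓_ : Ball → Ball → List Ball
  B ⊓ B' with nested-or-disjoint B B'
  ... | inj₁ _        = [ B ]
  ... | inj₂ (inj₁ _) = [ B' ]
  ... | inj₂ (inj₂ _) = []

  ∈⋃⊓⇔ : ∀ {x} B B' → x ∈⋃ B ⊓ B' ⇔ (x ∈B B × x ∈B B')
  ∈⋃⊓⇔ {x} B B' with nested-or-disjoint B B'
  ... | inj₁ B⊆B' =
    mk⇔ (λ x∈⋃ → let x∈B = singleton⁻ x∈⋃ in x∈B , B⊆B' x x∈B) (here ∘ proj₁)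
  ... | inj₂ (inj₁ B'⊆B) =
    mk⇔ (λ x∈⋃ → let x∈B' = singleton⁻ x∈⋃ in B'⊆B x x∈B' , x∈B') (here ∘ proj₂)
  ... | inj₂ (inj₂ B#B') =
    mk⇔ (λ ()) (λ (x∈B , x∈B') → contradiction x∈B' (B#B' x x∈B))

  ⊓-⊆ˡ : ∀ B B' → All (_⊆ᴮ B) (B ⊓ B')
  ⊓-⊆ˡ B B' with nested-or-disjoint B B'
  ... | inj₁ _           = ⊆-refl ∷ []
  ... | inj₂ (inj₁ B'⊆B) = B'⊆B ∷ []
  ... | inj₂ (inj₂ _)    = []

  ⊓-⊆ʳ : ∀ B B' → All (_⊆ᴮ B') (B ⊓ B')
  ⊓-⊆ʳ B B' with nested-or-disjoint B B'
  ... | inj₁ B⊆B'     = B⊆B' ∷ []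
  ... | inj₂ (inj₁ _) = ⊆-refl ∷ []
  ... | inj₂ (inj₂ _) = []

  ⊓-pairwise-disjoint : ∀ B B' → AllPairs Disjoint (B ⊓ B')
  ⊓-pairwise-disjoint B B' with nested-or-disjoint B B'
  ... | inj₁ _        = [] ∷ []
  ... | inj₂ (inj₁ _) = [] ∷ []
  ... | inj₂ (inj₂ _) = []

  ⊓-⊆ : ∀ B B' → B ⊓ B' ⊆ˡ B ∷ B' ∷ []
  ⊓-⊆ B B' with nested-or-disjoint B B'
  ... | inj₁ _        = λ { (here refl) → here refl }
  ... | inj₂ (inj₁ _) = λ { (here refl) → there (here refl) }
  ... | inj₂ (inj₂ _) = λ ()

  concatMap-pairwise-disjoint : ∀ (f : Ball → List Ball) {Bs} →
    (∀ B → All (_⊆ᴮ B) (f B)) → (∀ B → AllPairs Disjoint (f B)) →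
    AllPairs Disjoint Bs → AllPairs Disjoint (concatMap f Bs)
  concatMap-pairwise-disjoint f {Bs} f⊆ f-disjoint Bs-disjoint =
    AllPairs.concat⁺ (All.map⁺ (All.universal f-disjoint Bs))
                     (AllPairs.map⁺ (AllPairs.map across Bs-disjoint))
    where
    across : ∀ {B B'} → Disjoint B B' → All (λ A → All (Disjoint A) (f B')) (f B)
    across {B} {B'} B#B' =
      All.map (λ {A} A⊆B →
        All.map (λ {A'} A'⊆B' → Disjoint-⊆ {A} {A'} {B} {B'} A⊆B A'⊆B' B#B') (f⊆ B'))
        (f⊆ B)

  concatMap-⊆ˡ : ∀ (f : Ball → List Ball) {Bs Ds} → (∀ {B} → B ∈ Bs → f B ⊆ˡ Ds) →
                 concatMap f Bs ⊆ˡ Ds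
  concatMap-⊆ˡ f f⊆ A∈ with find (∈-concatMap⁻ f A∈)
  ... | B , B∈Bs , A∈fB = f⊆ B∈Bs A∈fB

  ∈⋃-meets⇔ : ∀ {x} B Ds → x ∈⋃ concatMap (B ⊓_) Ds ⇔ (x ∈B B × x ∈⋃ Ds)
  ∈⋃-meets⇔ {x} B Ds = mk⇔ to′ from′
    where
    to′ : x ∈⋃ concatMap (B ⊓_) Ds → x ∈B B × x ∈⋃ Ds
    to′ x∈⋃ with find (concatMap⁻ (B ⊓_) x∈⋃)
    ... | D , D∈Ds , x∈⋃B⊓D with to (∈⋃⊓⇔ B D) x∈⋃B⊓D
    ... | x∈B , x∈D = x∈B , lose D∈Ds x∈D
    from′ : x ∈B B × x ∈⋃ Ds → x ∈⋃ concatMap (B ⊓_) Ds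
    from′ (x∈B , x∈⋃Ds) with find x∈⋃Ds
    ... | D , D∈Ds , x∈D = concatMap⁺ (B ⊓_) (lose D∈Ds (from (∈⋃⊓⇔ B D) (x∈B , x∈D)))

  module Merge (B' : Ball) (Cs' : List Ball) where

    -- The second case also covers B' ⊆ C, which cannot happen when C is a hole of a swiss cheese
    -- meeting B' ∖ ⋃ Cs' (see ∈⋃remainder⇔).
    remainder : Ball → List Ball
    remainder C with nested-or-disjoint C B'
    ... | inj₁ _ = concatMap (C ⊓_) Cs'
    ... | inj₂ _ = [ C ]

    mergeHoles : List Ball → List Ball
    mergeHoles = concatMap remainder

    ∈⋃remainder⇔ : ∀ {x z} C → z ∈B B' → ¬ z ∈B C →
                   x ∈⋃ remainder C ⇔ (x ∈B C × (¬ x ∈B B' ⊎ x ∈⋃ Cs'))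
    ∈⋃remainder⇔ {x} {z} C z∈B' z∉C with nested-or-disjoint C B'
    ... | inj₁ C⊆B' = mk⇔
      (λ x∈⋃ → let (x∈C , x∈⋃Cs') = to (∈⋃-meets⇔ C Cs') x∈⋃ in x∈C , inj₂ x∈⋃Cs')
      (λ (x∈C , x∉B'-or-x∈⋃Cs') → from (∈⋃-meets⇔ C Cs')
         (x∈C , [ contradiction (C⊆B' x x∈C) , id ]′ x∉B'-or-x∈⋃Cs'))
    ... | inj₂ (inj₁ B'⊆C) = contradiction (B'⊆C z z∈B') z∉C
    ... | inj₂ (inj₂ C#B') = mk⇔
      (λ x∈⋃ → let x∈C = singleton⁻ x∈⋃ in x∈C , inj₁ (C#B' x x∈C))
      (here ∘ proj₁)

    ∈⋃mergeHoles⇔ : ∀ {x z Cs} → z ∈B B' → All (λ C → ¬ z ∈B C) Cs →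
                    x ∈⋃ mergeHoles Cs ⇔ (x ∈⋃ Cs × (¬ x ∈B B' ⊎ x ∈⋃ Cs'))
    ∈⋃mergeHoles⇔ {x} {z} {Cs} z∈B' z∉Cs = mk⇔ to′ from′
      where
      remainder⇔ : ∀ {C} → C ∈ Cs → x ∈⋃ remainder C ⇔ (x ∈B C × (¬ x ∈B B' ⊎ x ∈⋃ Cs'))
      remainder⇔ {C} C∈Cs = ∈⋃remainder⇔ C z∈B' (All.lookup z∉Cs C∈Cs)
      to′ : x ∈⋃ mergeHoles Cs → x ∈⋃ Cs × (¬ x ∈B B' ⊎ x ∈⋃ Cs')
      to′ x∈⋃ with find (concatMap⁻ remainder x∈⋃)
      ... | C , C∈Cs , x∈⋃remainder with to (remainder⇔ C∈Cs) x∈⋃remainder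
      ... | x∈C , rest = lose C∈Cs x∈C , rest
      from′ : x ∈⋃ Cs × (¬ x ∈B B' ⊎ x ∈⋃ Cs') → x ∈⋃ mergeHoles Cs
      from′ (x∈⋃Cs , rest) with find x∈⋃Cs
      ... | C , C∈Cs , x∈C = concatMap⁺ remainder (lose C∈Cs (from (remainder⇔ C∈Cs) (x∈C , rest)))

    remainder-⊆ᴮ : ∀ C → All (_⊆ᴮ C) (remainder C)
    remainder-⊆ᴮ C with nested-or-disjoint C B'
    ... | inj₁ _ = All.concat⁺ (All.map⁺ (All.universal (⊓-⊆ˡ C) Cs'))
    ... | inj₂ _ = ⊆-refl ∷ []

    remainder-pairwise-disjoint : AllPairs Disjoint Cs' → ∀ C → AllPairs Disjoint (remainder C)
    remainder-pairwise-disjoint Cs'-disjoint C with nested-or-disjoint C B'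
    ... | inj₁ _ =
      concatMap-pairwise-disjoint (C ⊓_) (⊓-⊆ʳ C) (⊓-pairwise-disjoint C) Cs'-disjoint
    ... | inj₂ _ = [] ∷ []

    mergeHoles-pairwise-disjoint : ∀ {Cs} → AllPairs Disjoint Cs → AllPairs Disjoint Cs' →
                                   AllPairs Disjoint (mergeHoles Cs)
    mergeHoles-pairwise-disjoint Cs-disjoint Cs'-disjoint =
      concatMap-pairwise-disjoint remainder remainder-⊆ᴮ
        (remainder-pairwise-disjoint Cs'-disjoint) Cs-disjoint

    remainder-⊆ : ∀ C → remainder C ⊆ˡ C ∷ Cs'
    remainder-⊆ C with nested-or-disjoint C B'
    ... | inj₁ _ = concatMap-⊆ˡ (C ⊓_) {Cs'} λ D∈Cs' A∈C⊓D →
      case ⊓-⊆ C _ A∈C⊓D of λ where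
        (here refl)         → here refl
        (there (here refl)) → there D∈Cs'
    ... | inj₂ _ = λ { (here refl) → here refl }

    mergeHoles-⊆ : ∀ Cs → mergeHoles Cs ⊆ˡ Cs ++ Cs'
    mergeHoles-⊆ Cs = concatMap-⊆ˡ remainder {Cs} λ C∈Cs A∈remainder →
      case remainder-⊆ _ A∈remainder of λ where
        (here refl)   → ∈-++⁺ˡ C∈Cs
        (there A∈Cs') → ∈-++⁺ʳ Cs A∈Cs'

    all-mergeHoles : ∀ {P : Ball → Set} Cs → All P (Cs ++ Cs') → All P (mergeHoles Cs)
    all-mergeHoles Cs Ps = All.tabulate (All.lookup Ps ∘ mergeHoles-⊆ Cs)

    ∪-≐-Diff-mergeHoles : ∀ F F' B {Cs} → F ≐ Diff B Cs → F' ≐ Diff B' Cs' → B' ⊆ᴮ B →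
                          ∀ {z} → F z → F' z → (F ∪ F') ≐ Diff B (mergeHoles Cs)
    ∪-≐-Diff-mergeHoles F F' B {Cs} (F⊆ , ⊆F) (F'⊆ , ⊆F') B'⊆B {z} zF zF' = to′ , from′
      where
      holes⇔ : ∀ {x} → x ∈⋃ mergeHoles Cs ⇔ (x ∈⋃ Cs × (¬ x ∈B B' ⊎ x ∈⋃ Cs'))
      holes⇔ = ∈⋃mergeHoles⇔ (proj₁ (F'⊆ z zF')) (proj₂ (F⊆ z zF))
      to′ : (F ∪ F') ⊆ Diff B (mergeHoles Cs)
      to′ x (inj₁ xF) with F⊆ x xF
      ... | x∈B , x∉⋃Cs = x∈B , ¬Any⇒All¬ _ (All¬⇒¬Any x∉⋃Cs ∘ proj₁ ∘ to holes⇔)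
      to′ x (inj₂ xF') with F'⊆ x xF'
      ... | x∈B' , x∉⋃Cs' = B'⊆B x x∈B' ,
        ¬Any⇒All¬ _ ([ contradiction x∈B' , All¬⇒¬Any x∉⋃Cs' ]′ ∘ proj₂ ∘ to holes⇔)
      from′ : Diff B (mergeHoles Cs) ⊆ (F ∪ F')
      from′ x (x∈B , x∉⋃holes) with any? (x ∈B?_) Cs | x ∈B? B' | any? (x ∈B?_) Cs'
      ... | no x∉⋃Cs | _ | _ = inj₁ (⊆F x (x∈B , ¬Any⇒All¬ Cs x∉⋃Cs))
      ... | yes x∈⋃Cs | no x∉B' | _ =
        contradiction (from holes⇔ (x∈⋃Cs , inj₁ x∉B')) (All¬⇒¬Any x∉⋃holes)
      ... | yes x∈⋃Cs | yes _ | yes x∈⋃Cs' =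
        contradiction (from holes⇔ (x∈⋃Cs , inj₂ x∈⋃Cs')) (All¬⇒¬Any x∉⋃holes)
      ... | yes _ | yes x∈B' | no x∉⋃Cs' = inj₂ (⊆F' x (x∈B' , ¬Any⇒All¬ Cs' x∉⋃Cs'))

  open Merge public
    using (mergeHoles; mergeHoles-⊆; all-mergeHoles; mergeHoles-pairwise-disjoint; ∪-≐-Diff-mergeHoles)

  outer-minimal : ∀ {F} B B₂ → IsOuterBall F B → IsOuterBall F B₂ → B ⊆ᴮ B₂
  outer-minimal B B₂ (_ , B-minimal) (F⊆B₂ , _) = B-minimal B₂ F⊆B₂

  outer-nested : ∀ {F F'} B B' → IsOuterBall F B → IsOuterBall F' B' → radius B ≤Γ radius B' →
                 ∀ {z} → F z → F' z → B' ⊆ᴮ B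
  outer-nested B B' (F⊆B , _) (F'⊆B' , _) r≤r' {z} zF zF' =
    ∈B-nested B B' r≤r' z (F⊆B z zF) (F'⊆B' z zF')

  outer-∪ : ∀ {F} F' B → IsOuterBall F B → F' ⊆ ballSet B → IsOuterBall (F ∪ F') B
  outer-∪ _ _ (F⊆B , B-minimal) F'⊆B =
    (λ x → [ F⊆B x , F'⊆B x ]′) , (λ B₂ F∪F'⊆B₂ → B-minimal B₂ (λ x → F∪F'⊆B₂ x ∘ inj₁))

  Diff-outer : ∀ {F Cs} B C → IsOuterBall F B → F ≐ Diff C Cs → F ≐ Diff B Cs
  Diff-outer B C (F⊆B , B-minimal) (F⊆ , ⊆F) =
    (λ x xF → F⊆B x xF , proj₂ (F⊆ x xF)) ,
    (λ x (x∈B , x∉⋃Cs) → ⊆F x (B-minimal C (λ y → proj₁ ∘ F⊆ y) x x∈B , x∉⋃Cs))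

  mergeRepresentations : ∀ {F F' z} (R : Representation F) (R' : Representation F') →
    outer R' ⊆ᴮ outer R → F z → F' z → Representation (F ∪ F')
  mergeRepresentations {F} {F'} R R' O'⊆O zF zF' = record
    { outer         = outer R
    ; holes         = mergeHoles O' Cs' Cs
    ; outerIsOuter  = outer-∪ F' (outer R) (outerIsOuter R) (λ x → O'⊆O x ∘ proj₁ (outerIsOuter R') x)
    ; holesNonempty = all-mergeHoles O' Cs' Cs (All.++⁺ (holesNonempty R) (holesNonempty R'))
    ; holesDisjoint = mergeHoles-pairwise-disjoint O' Cs' (holesDisjoint R) (holesDisjoint R')
    ; holesInOuter  = all-mergeHoles O' Cs' Cs
                        (All.++⁺ (holesInOuter R) (All.map (λ H⊆O' x → O'⊆O x ∘ H⊆O' x) (holesInOuter R')))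
    ; represents    = ∪-≐-Diff-mergeHoles O' Cs' F F' (outer R) (represents R) (represents R') O'⊆O zF zF'
    }
    where
    O' = outer R'
    Cs = holes R
    Cs' = holes R'

lemma5p4 : (p : ℕ) → Prime p → (𝓜 : Structure) → IsModelOfTp p 𝓜 →
    let open Cheese 𝓜 in
    (F F' : Pred) (γ γ' : Structure.Γ 𝓜) →
    IsSwissCheese F → IsSwissCheese F' →
    HasRadius F γ → HasRadius F' γ' → γ ≤Γ γ' →
    Nonempty (λ x → F x × F' x) →
    IsSwissCheese (F ∪ F') × HasRadius (F ∪ F') γ
      × ((R : Representation F) (R' : Representation F') →
         Σ (Representation (F ∪ F')) λ R'' →
           All (λ H → Any (λ H' → ballSet H ≐ ballSet H') (holes R ++ holes R')) (holes R''))
lemma5p4 p p-prime 𝓜 ⊨Tp F F' _ _ (_ , C , Cs , F≐) (_ , C' , Cs' , F'≐)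
         (B , B-outer , refl) (B' , B'-outer , refl) r≤r' (z , zF , zF') =
  ((z , inj₁ zF) , B , mergeHoles B' Cs' Cs ,
     ∪-≐-Diff-mergeHoles B' Cs' F F' B (Diff-outer B C B-outer F≐) (Diff-outer B' C' B'-outer F'≐)
                         B'⊆B zF zF') ,
  (B , outer-∪ F' B B-outer (λ x → B'⊆B x ∘ proj₁ B'-outer x) , refl) ,
  λ R R' → mergeRepresentations R R' (outer-R'⊆outer-R R R') zF zF' ,
           All.tabulate (Any.map (λ { refl → ≐-refl }) ∘ mergeHoles-⊆ (outer R') (holes R') (holes R))
  where
  open Cheese 𝓜
  open BallCombinatorics (ballAxioms p p-prime 𝓜 ⊨Tp)
  B'⊆B : B' ⊆ᴮ B
  B'⊆B = outer-nested B B' B-outer B'-outer r≤r' zF zF'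
  outer-R'⊆outer-R : (R : Representation F) (R' : Representation F') → outer R' ⊆ᴮ outer R
  outer-R'⊆outer-R R R' x =
    outer-minimal B (outer R) B-outer (outerIsOuter R) x ∘ B'⊆B x ∘
    outer-minimal (outer R') B' (outerIsOuter R') B'-outer x
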